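{- Let $\Gamma$ be a set of formulas. Then $\mathsf{ICK}\oplus\Gamma$ is sound and complete with respect to the class of general conditional frames that validate every formula in $\Gamma$.
   Context: Formulas: $\phi::=p\mid\bot\mid\phi\wedge\phi\mid\phi\vee\phi\mid\phi\to\phi\mid\phi>\phi$, $\top:=\bot\to\bot$. $\mathsf{ICK}\oplus\Gamma$ is the smallest set of formulas containing the axioms of intuitionistic propositional logic, $\Gamma$, $(p>(q\wedge r))\leftrightarrow((p>q)\wedge(p>r))$ and $(p>\top)\leftrightarrow\top$, closed under uniform substitution, modus ponens and the rules: from $\phi\leftrightarrow\psi$ infer $(\phi>\chi)\leftrightarrow(\psi>\chi)$ and $(\chi>\phi)\leftrightarrow(\chi>\psi)$. A general conditional frame is $(X,\le,\mathcal R,A)$ with $(X,\le)$ a poset, $A$ a set of upsets, and $\mathcal R=\{R_a:a\in A\}$ relations on $X$ such that $A$ contains $X,\emptyset$ and is closed under $\cap$, $\cup$, $a\to b:=\{x:{\uparrow}x\cap a\subseteq b\}$ and $a\Rightarrow b:=\{x: R_a[x]\subseteq b\}$, and for each $a\in A$, whenever $x\le y R_a z$ there is $w$ with $xR_aw\le z$. A formula is valid on it if it holds at every world under every valuation into $A$, with intuitionistic Kripke clauses and $x\models\phi>\psi$ iff all $y$ with $xR_{V(\phi)}y$ satisfy $\psi$. Sound and complete means: $\phi\in\mathsf{ICK}\oplus\Gamma$ iff $\phi$ is valid on all members of the class. -}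

module Defs where

open import Level using (Level; _⊔_; Lift; lift) renaming (suc to lsuc; zero to lzero)
open import Data.Nat using (ℕ)
open import Data.Empty using (⊥)
open import Data.Unit using (⊤)
open import Data.Product using (Σ; _×_; _,_; ∃)
open import Data.Sum using (_⊎_)
open import Relation.Binary.PropositionalEquality using (_≡_)
open import Relation.Binary.Structures using (IsPartialOrder)

infixr 6 _∧'_
infixr 5 _∨'_
infixr 4 _⇒'_ _▷_
infixr 3 _⇔'_

data Formula : Set where
  var  : ℕ → Formula
  bot  : Formula
  _∧'_ : Formula → Formula → Formula
  _∨'_ : Formula → Formula → Formula
  _⇒'_ : Formula → Formula → Formula
  _▷_  : Formula → Formula → Formula

top : Formula
top = bot ⇒' bot

_⇔'_ : Formula → Formula → Formula
φ ⇔' ψ = (φ ⇒' ψ) ∧' (ψ ⇒' φ)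

subst : (ℕ → Formula) → Formula → Formula
subst σ (var n)  = σ n
subst σ bot      = bot
subst σ (φ ∧' ψ) = subst σ φ ∧' subst σ ψ
subst σ (φ ∨' ψ) = subst σ φ ∨' subst σ ψ
subst σ (φ ⇒' ψ) = subst σ φ ⇒' subst σ ψ
subst σ (φ ▷ ψ)  = subst σ φ ▷ subst σ ψ

p q r : Formula
p = var 0
q = var 1
r = var 2

data IPCAxiom : Formula → Set where
  K    : ∀ φ ψ → IPCAxiom (φ ⇒' (ψ ⇒' φ))
  S    : ∀ φ ψ χ → IPCAxiom ((φ ⇒' (ψ ⇒' χ)) ⇒' ((φ ⇒' ψ) ⇒' (φ ⇒' χ)))
  ∧E₁  : ∀ φ ψ → IPCAxiom ((φ ∧' ψ) ⇒' φ)
  ∧E₂  : ∀ φ ψ → IPCAxiom ((φ ∧' ψ) ⇒' ψ)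
  ∧I   : ∀ φ ψ → IPCAxiom (φ ⇒' (ψ ⇒' (φ ∧' ψ)))
  ∨I₁  : ∀ φ ψ → IPCAxiom (φ ⇒' (φ ∨' ψ))
  ∨I₂  : ∀ φ ψ → IPCAxiom (ψ ⇒' (φ ∨' ψ))
  ∨E   : ∀ φ ψ χ → IPCAxiom ((φ ⇒' χ) ⇒' ((ψ ⇒' χ) ⇒' ((φ ∨' ψ) ⇒' χ)))
  efq  : ∀ φ → IPCAxiom (bot ⇒' φ)

data ICK (Γ : Formula → Set) : Formula → Set where
  ipc   : ∀ {φ} → IPCAxiom φ → ICK Γ φ
  hyp   : ∀ {φ} → Γ φ → ICK Γ φ
  CM    : ICK Γ ((p ▷ (q ∧' r)) ⇔' ((p ▷ q) ∧' (p ▷ r)))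
  CN    : ICK Γ ((p ▷ top) ⇔' top)
  usub  : ∀ {φ} (σ : ℕ → Formula) → ICK Γ φ → ICK Γ (subst σ φ)
  mp    : ∀ {φ ψ} → ICK Γ (φ ⇒' ψ) → ICK Γ φ → ICK Γ ψ
  congL : ∀ {φ ψ} χ → ICK Γ (φ ⇔' ψ) → ICK Γ ((φ ▷ χ) ⇔' (ψ ▷ χ))
  congR : ∀ {φ ψ} χ → ICK Γ (φ ⇔' ψ) → ICK Γ ((χ ▷ φ) ⇔' (χ ▷ ψ))

-- Subsets of X are predicates X → Set ℓ;
-- since Agda predicates are intensional, we require the set A of upsets and
-- the assignment a ↦ R_a to respect extensional equality of subsets
-- (automatic for sets in set theory).

module _ {ℓ : Level} {X : Set ℓ} where
  Subset : Set (lsuc ℓ)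
  Subset = X → Set ℓ

  _≐_ : Subset → Subset → Set ℓ
  a ≐ b = ∀ x → (a x → b x) × (b x → a x)

record GFrame (ℓ : Level) : Set (lsuc ℓ) where
  field
    X      : Set ℓ
    _≤_    : X → X → Set ℓ
    isPO   : IsPartialOrder _≡_ _≤_
    A      : (X → Set ℓ) → Set ℓ
    R      : (X → Set ℓ) → X → X → Set ℓ  -- R a  is the relation R_a (relevant for a ∈ A)
    A-ext  : ∀ {a b} → a ≐ b → A a → A b
    R-ext  : ∀ {a b} → A a → A b → a ≐ b → ∀ {x y} → R a x y → R b x y
    A-up   : ∀ {a} → A a → ∀ {x y} → x ≤ y → a x → a y
    A-X    : A (λ _ → Lift ℓ ⊤)
    A-∅    : A (λ _ → Lift ℓ ⊥)
    A-∩    : ∀ {a b} → A a → A b → A (λ x → a x × b x)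
    A-∪    : ∀ {a b} → A a → A b → A (λ x → a x ⊎ b x)
    A-→    : ∀ {a b} → A a → A b → A (λ x → ∀ y → x ≤ y → a y → b y)
    A-⇒    : ∀ {a b} → A a → A b → A (λ x → ∀ y → R a x y → b y)
    R-cond : ∀ {a} → A a → ∀ {x y z} → x ≤ y → R a y z → Σ X (λ w → R a x w × w ≤ z)

module _ {ℓ : Level} (F : GFrame ℓ) where
  open GFrame F

  ⟦_⟧ : Formula → (ℕ → X → Set ℓ) → X → Set ℓ
  ⟦ var n ⟧  V x = V n x
  ⟦ bot ⟧    V x = Lift ℓ ⊥
  ⟦ φ ∧' ψ ⟧ V x = ⟦ φ ⟧ V x × ⟦ ψ ⟧ V x
  ⟦ φ ∨' ψ ⟧ V x = ⟦ φ ⟧ V x ⊎ ⟦ ψ ⟧ V x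
  ⟦ φ ⇒' ψ ⟧ V x = ∀ y → x ≤ y → ⟦ φ ⟧ V y → ⟦ ψ ⟧ V y
  ⟦ φ ▷ ψ ⟧  V x = ∀ y → R (⟦ φ ⟧ V) x y → ⟦ ψ ⟧ V y

  Valid : Formula → Set (lsuc ℓ)
  Valid φ = (V : ℕ → X → Set ℓ) → (∀ n → A (V n)) → ∀ x → ⟦ φ ⟧ V x

  ValidAll : (Formula → Set) → Set (lsuc ℓ)
  ValidAll Γ = ∀ {γ} → Γ γ → Valid γ

-- Soundness is an induction on derivations; the congruence rules are sound because the truth set of
-- every formula lies in A and R_a depends only on the extension of a.
-- For completeness, the worlds of the canonical frame are the prime theories, obtained by a Lindenbaum
-- construction along an enumeration of all formulas (the one use of excluded middle). A consists of
-- the sets φ̂ = {w | φ ∈ w}, and v R_φ̂ w iff ψ ∈ w whenever φ > ψ ∈ v. The congruence rule for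
-- antecedents makes R independent of the choice of φ, and CM and CN make {χ | φ > χ ∈ v} deductively
-- closed, which is what the truth lemma needs for conditionals. An admissible valuation amounts to a
-- substitution, so the canonical frame validates Γ.
module Submission where

open import Level using (Level; 0ℓ; Lift; lift; lower) renaming (suc to lsuc)
open import Data.Empty using (⊥; ⊥-elim)
open import Data.Unit using (⊤)
open import Data.Bool using (Bool; T)
open import Data.Nat using (ℕ; zero; suc; _⊔_; _≤′_; ≤′-refl; ≤′-step)
open import Data.Nat.Properties using (m≤m⊔n; m≤n⊔m; ≤⇒≤′)
open import Data.Product using (∃; _×_; _,_; proj₁; proj₂)
import Data.Product as Product
open import Data.Sum using (_⊎_; inj₁; inj₂)
import Data.Sum as Sum
open import Data.List using (List; []; _∷_; _++_; foldl; concatMap; cartesianProductWith)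
open import Data.List.Membership.Propositional using (_∈_)
open import Data.List.Membership.Propositional.Properties
  using (∈-++⁺ˡ; ∈-++⁺ʳ; ∈-concatMap⁺; ∈-cartesianProductWith⁺)
open import Data.List.Relation.Unary.Any using (here; there)
import Data.List.Relation.Unary.Any as Any
open import Function using (id; _∘_)
open import Relation.Binary.Structures using (IsPartialOrder)
open import Relation.Binary.PropositionalEquality using (_≡_; refl; sym; isEquivalence)
open import Relation.Nullary using (Dec; yes; no; ¬_)
open import Relation.Nullary.Decidable using (map′; isYes; toWitness; fromWitness)
open import Relation.Unary using (Pred; _⊆_; _∩_; _∪_; _⇒_; ∅; ｛_｝)
open import Axiom.ExcludedMiddle using (ExcludedMiddle)
open import Defs hiding (⟦_⟧)

module _ {ℓ : Level} {X : Set ℓ} where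

  ≐-refl : {a : X → Set ℓ} → a ≐ a
  ≐-refl x = id , id

  ≐-sym : {a b : X → Set ℓ} → a ≐ b → b ≐ a
  ≐-sym e x = Product.swap (e x)

  ≐-trans : {a b c : X → Set ℓ} → a ≐ b → b ≐ c → a ≐ c
  ≐-trans e f x = proj₁ (f x) ∘ proj₁ (e x) , proj₂ (e x) ∘ proj₂ (f x)

  □[_] : (X → X → Set ℓ) → Pred X ℓ → Pred X ℓ
  □[ Q ] b x = ∀ y → Q x y → b y

  module _ {a a′ b b′ : X → Set ℓ} (a≐a′ : a ≐ a′) (b≐b′ : b ≐ b′) where

    ∩-resp-≐ : (a ∩ b) ≐ (a′ ∩ b′)
    ∩-resp-≐ x = Product.map (proj₁ (a≐a′ x)) (proj₁ (b≐b′ x))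
               , Product.map (proj₂ (a≐a′ x)) (proj₂ (b≐b′ x))

    ∪-resp-≐ : (a ∪ b) ≐ (a′ ∪ b′)
    ∪-resp-≐ x = Sum.map (proj₁ (a≐a′ x)) (proj₁ (b≐b′ x))
               , Sum.map (proj₂ (a≐a′ x)) (proj₂ (b≐b′ x))

    ⇒-resp-≐ : (a ⇒ b) ≐ (a′ ⇒ b′)
    ⇒-resp-≐ x = (λ h → proj₁ (b≐b′ x) ∘ h ∘ proj₂ (a≐a′ x))
               , (λ h → proj₂ (b≐b′ x) ∘ h ∘ proj₁ (a≐a′ x))

  □-resp-≐ : ∀ {Q Q′ : X → X → Set ℓ} {b b′ : X → Set ℓ} →
             (∀ x y → Q x y → Q′ x y) → (∀ x y → Q′ x y → Q x y) →
             b ≐ b′ → □[ Q ] b ≐ □[ Q′ ] b′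
  □-resp-≐ Q⇒Q′ Q′⇒Q b≐b′ x = (λ h y q → proj₁ (b≐b′ y) (h y (Q′⇒Q x y q)))
                            , (λ h y q → proj₂ (b≐b′ y) (h y (Q⇒Q′ x y q)))

  □-respʳ-≐ : ∀ {Q : X → X → Set ℓ} {b b′ : X → Set ℓ} → b ≐ b′ → □[ Q ] b ≐ □[ Q ] b′
  □-respʳ-≐ = □-resp-≐ (λ _ _ → id) (λ _ _ → id)

  □⇒-resp-≐ : ∀ {Q : X → X → Set ℓ} {a a′ b b′ : X → Set ℓ} →
              a ≐ a′ → b ≐ b′ → □[ Q ] (a ⇒ b) ≐ □[ Q ] (a′ ⇒ b′)
  □⇒-resp-≐ a≐a′ b≐b′ = □-respʳ-≐ (⇒-resp-≐ a≐a′ b≐b′)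

module Soundness {ℓ : Level} (F : GFrame ℓ) where
  open GFrame F
  open IsPartialOrder isPO using () renaming (refl to ≤-refl; trans to ≤-trans)

  Valuation : Set (lsuc ℓ)
  Valuation = ℕ → X → Set ℓ

  Admissible : Valuation → Set ℓ
  Admissible V = ∀ n → A (V n)

  infix 25 ⟦_⟧_
  ⟦_⟧_ : Formula → Valuation → X → Set ℓ
  ⟦ φ ⟧ V = Defs.⟦_⟧ F φ V

  ⟦⟧∈A : ∀ {V} → Admissible V → ∀ φ → A (⟦ φ ⟧ V)
  ⟦⟧∈A AV (var n)  = AV n
  ⟦⟧∈A AV bot      = A-∅
  ⟦⟧∈A AV (φ ∧' ψ) = A-∩ (⟦⟧∈A AV φ) (⟦⟧∈A AV ψ)
  ⟦⟧∈A AV (φ ∨' ψ) = A-∪ (⟦⟧∈A AV φ) (⟦⟧∈A AV ψ)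
  ⟦⟧∈A AV (φ ⇒' ψ) = A-→ (⟦⟧∈A AV φ) (⟦⟧∈A AV ψ)
  ⟦⟧∈A AV (φ ▷ ψ)  = A-⇒ (⟦⟧∈A AV φ) (⟦⟧∈A AV ψ)

  ▷-resp-≐ : ∀ {a a′ b b′} → A a → A a′ → a ≐ a′ → b ≐ b′ → □[ R a ] b ≐ □[ R a′ ] b′
  ▷-resp-≐ Aa Aa′ a≐a′ = □-resp-≐ (λ _ _ → R-ext Aa Aa′ a≐a′) (λ _ _ → R-ext Aa′ Aa (≐-sym a≐a′))

  ⟦⟧-subst : ∀ {V W} → Admissible V → Admissible W → (σ : ℕ → Formula) →
             (∀ n → W n ≐ ⟦ σ n ⟧ V) → ∀ φ → ⟦ φ ⟧ W ≐ ⟦ subst σ φ ⟧ V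
  ⟦⟧-subst {V} {W} AV AW σ W≐σ = go
    where
      go : ∀ φ → ⟦ φ ⟧ W ≐ ⟦ subst σ φ ⟧ V
      go (var n)  = W≐σ n
      go bot      = ≐-refl
      go (φ ∧' ψ) = ∩-resp-≐ (go φ) (go ψ)
      go (φ ∨' ψ) = ∪-resp-≐ (go φ) (go ψ)
      go (φ ⇒' ψ) = □⇒-resp-≐ (go φ) (go ψ)
      go (φ ▷ ψ)  = ▷-resp-≐ (⟦⟧∈A AW φ) (⟦⟧∈A AV (subst σ φ)) (go φ) (go ψ)

  valid-subst : ∀ {φ} (σ : ℕ → Formula) → Valid F φ → Valid F (subst σ φ)
  valid-subst {φ} σ ⊨φ V AV x =
    proj₁ (⟦⟧-subst AV (λ n → ⟦⟧∈A AV (σ n)) σ (λ n → ≐-refl) φ x)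
          (⊨φ (λ n → ⟦ σ n ⟧ V) (λ n → ⟦⟧∈A AV (σ n)) x)

  ⇔-valid⇒≐ : ∀ {φ ψ} → Valid F (φ ⇔' ψ) → ∀ V → Admissible V → ⟦ φ ⟧ V ≐ ⟦ ψ ⟧ V
  ⇔-valid⇒≐ ⊨φ⇔ψ V AV x = (λ u → proj₁ (⊨φ⇔ψ V AV x) x ≤-refl u)
                       , (λ u → proj₂ (⊨φ⇔ψ V AV x) x ≤-refl u)

  ≐⇒⇔-valid : ∀ {φ ψ} → (∀ V → Admissible V → ⟦ φ ⟧ V ≐ ⟦ ψ ⟧ V) → Valid F (φ ⇔' ψ)
  ≐⇒⇔-valid φ≐ψ V AV x = (λ y _ → proj₁ (φ≐ψ V AV y)) , (λ y _ → proj₂ (φ≐ψ V AV y))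

  ipc-valid : ∀ {φ} → IPCAxiom φ → Valid F φ
  ipc-valid (K φ _)     _ AV _ _ _ u _ y≤z _ = A-up (⟦⟧∈A AV φ) y≤z u
  ipc-valid (S _ _ _)   _ _ _ _ _ f _ y≤z g w z≤w u = f w (≤-trans y≤z z≤w) u w ≤-refl (g w z≤w u)
  ipc-valid (∧E₁ _ _)   _ _ _ _ _ (u , _) = u
  ipc-valid (∧E₂ _ _)   _ _ _ _ _ (_ , v) = v
  ipc-valid (∧I φ _)    _ AV _ _ _ u _ y≤z v = A-up (⟦⟧∈A AV φ) y≤z u , v
  ipc-valid (∨I₁ _ _)   _ _ _ _ _ = inj₁
  ipc-valid (∨I₂ _ _)   _ _ _ _ _ = inj₂
  ipc-valid (∨E _ _ _)  _ _ _ _ _ f _ y≤z _ w z≤w (inj₁ u) = f w (≤-trans y≤z z≤w) u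
  ipc-valid (∨E _ _ _)  _ _ _ _ _ _ _ _ g w z≤w (inj₂ v) = g w z≤w v
  ipc-valid (efq _)     _ _ _ _ _ ()

  sound : ∀ {Γ φ} → ValidAll F Γ → ICK Γ φ → Valid F φ
  sound ⊨Γ (ipc ax) = ipc-valid ax
  sound ⊨Γ (hyp γ)  = ⊨Γ γ
  sound ⊨Γ CM = ≐⇒⇔-valid {p ▷ (q ∧' r)} {(p ▷ q) ∧' (p ▷ r)} λ _ _ _ →
    (λ h → (λ y → proj₁ ∘ h y) , (λ y → proj₂ ∘ h y)) , (λ (f , g) y r → f y r , g y r)
  sound ⊨Γ CN = ≐⇒⇔-valid {p ▷ top} {top} λ _ _ _ → (λ _ _ _ → id) , (λ _ _ _ _ _ → id)
  sound ⊨Γ (usub {φ} σ d) = valid-subst {φ} σ (sound ⊨Γ d)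
  sound ⊨Γ (mp d e) V AV x = sound ⊨Γ d V AV x x ≤-refl (sound ⊨Γ e V AV x)
  sound ⊨Γ (congL {φ} {ψ} χ d) = ≐⇒⇔-valid {φ ▷ χ} {ψ ▷ χ} λ V AV →
    ▷-resp-≐ (⟦⟧∈A AV φ) (⟦⟧∈A AV ψ) (⇔-valid⇒≐ {φ} {ψ} (sound ⊨Γ d) V AV) ≐-refl
  sound ⊨Γ (congR {φ} {ψ} χ d) = ≐⇒⇔-valid {χ ▷ φ} {χ ▷ ψ} λ V AV →
    □-respʳ-≐ (⇔-valid⇒≐ {φ} {ψ} (sound ⊨Γ d) V AV)

binaryConnectives : List (Formula → Formula → Formula)
binaryConnectives = _∧'_ ∷ _∨'_ ∷ _⇒'_ ∷ _▷_ ∷ []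

applications : List Formula → (Formula → Formula → Formula) → List Formula
applications φs c = cartesianProductWith c φs φs

formulas : ℕ → List Formula
formulas zero    = []
formulas (suc n) =
  bot ∷ var n ∷ formulas n ++ concatMap (applications (formulas n)) binaryConnectives

formulas-mono : ∀ {m n φ} → m ≤′ n → φ ∈ formulas m → φ ∈ formulas n
formulas-mono ≤′-refl        = id
formulas-mono (≤′-step m≤′n) = there ∘ there ∘ ∈-++⁺ˡ ∘ formulas-mono m≤′n

∈-formulas-connective : ∀ {c φ ψ} → c ∈ binaryConnectives →
                        ∃ (λ m → φ ∈ formulas m) → ∃ (λ n → ψ ∈ formulas n) →
                        ∃ (λ k → c φ ψ ∈ formulas k)
∈-formulas-connective {c} {φ} {ψ} c∈ (m , φ∈) (n , ψ∈) =
  suc (m ⊔ n) , there (there (∈-++⁺ʳ (formulas (m ⊔ n)) (∈-concatMap⁺ (applications (formulas (m ⊔ n)))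
                                                                      (Any.map cφψ∈ c∈))))
  where
    cφψ∈ : ∀ {c′} → c ≡ c′ → c φ ψ ∈ applications (formulas (m ⊔ n)) c′
    cφψ∈ refl = ∈-cartesianProductWith⁺ c (formulas-mono (≤⇒≤′ (m≤m⊔n m n)) φ∈)
                                          (formulas-mono (≤⇒≤′ (m≤n⊔m m n)) ψ∈)

formulas-complete : ∀ φ → ∃ λ n → φ ∈ formulas n
formulas-complete (var k)  = suc k , there (here refl)
formulas-complete bot      = 1 , here refl
formulas-complete (φ ∧' ψ) =
  ∈-formulas-connective (here refl) (formulas-complete φ) (formulas-complete ψ)
formulas-complete (φ ∨' ψ) =
  ∈-formulas-connective (there (here refl)) (formulas-complete φ) (formulas-complete ψ)
formulas-complete (φ ⇒' ψ) =
  ∈-formulas-connective (there (there (here refl))) (formulas-complete φ) (formulas-complete ψ)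
formulas-complete (φ ▷ ψ)  =
  ∈-formulas-connective (there (there (there (here refl)))) (formulas-complete φ) (formulas-complete ψ)

module Derivability (Γ : Formula → Set) where

  infix 3.5 _⊩_
  data _⊩_ (D : Pred Formula 0ℓ) : Formula → Set where
    by-thm : ∀ {φ} → ICK Γ φ → D ⊩ φ
    by-hyp : ∀ {φ} → D φ → D ⊩ φ
    by-mp  : ∀ {φ ψ} → D ⊩ φ ⇒' ψ → D ⊩ φ → D ⊩ ψ

  by-ax : ∀ {D φ} → IPCAxiom φ → D ⊩ φ
  by-ax = by-thm ∘ ipc

  ⊩-mono : ∀ {D E φ} → D ⊆ E → D ⊩ φ → E ⊩ φ
  ⊩-mono D⊆E (by-thm t)  = by-thm t
  ⊩-mono D⊆E (by-hyp h)  = by-hyp (D⊆E h)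
  ⊩-mono D⊆E (by-mp d e) = by-mp (⊩-mono D⊆E d) (⊩-mono D⊆E e)

  ∅⊩⇒ICK : ∀ {φ} → ∅ ⊩ φ → ICK Γ φ
  ∅⊩⇒ICK (by-thm t)  = t
  ∅⊩⇒ICK (by-mp d e) = mp (∅⊩⇒ICK d) (∅⊩⇒ICK e)

  ⇒-refl : ∀ φ → ICK Γ (φ ⇒' φ)
  ⇒-refl φ = mp (mp (ipc (S φ (φ ⇒' φ) φ)) (ipc (K φ (φ ⇒' φ)))) (ipc (K φ φ))

  ⊩-deduction : ∀ {D α ψ} → D ∪ ｛ α ｝ ⊩ ψ → D ⊩ α ⇒' ψ
  ⊩-deduction (by-thm t)           = by-mp (by-ax (K _ _)) (by-thm t)
  ⊩-deduction (by-hyp (inj₁ h))    = by-mp (by-ax (K _ _)) (by-hyp h)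
  ⊩-deduction (by-hyp (inj₂ refl)) = by-thm (⇒-refl _)
  ⊩-deduction (by-mp d e)          = by-mp (by-mp (by-ax (S _ _ _)) (⊩-deduction d)) (⊩-deduction e)

  ⇔-intro : ∀ {φ ψ} → ICK Γ (φ ⇒' ψ) → ICK Γ (ψ ⇒' φ) → ICK Γ (φ ⇔' ψ)
  ⇔-intro t u = mp (mp (ipc (∧I _ _)) t) u

  ⇔-to : ∀ {φ ψ} → ICK Γ (φ ⇔' ψ) → ICK Γ (φ ⇒' ψ)
  ⇔-to = mp (ipc (∧E₁ _ _))

  ⇔-from : ∀ {φ ψ} → ICK Γ (φ ⇔' ψ) → ICK Γ (ψ ⇒' φ)
  ⇔-from = mp (ipc (∧E₂ _ _))

  CM-instance : ∀ φ α β → ICK Γ ((φ ▷ (α ∧' β)) ⇔' ((φ ▷ α) ∧' (φ ▷ β)))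
  CM-instance φ α β = usub (λ { 0 → φ ; 1 → α ; _ → β }) CM

  CN-instance : ∀ φ → ICK Γ ((φ ▷ top) ⇔' top)
  CN-instance φ = usub (λ _ → φ) CN

module Canonical (Γ : Formula → Set) {ℓ : Level} (em : ExcludedMiddle ℓ) where
  open Derivability Γ

  decide : (P : Set) → Dec P
  decide P = map′ lower lift (em {Lift ℓ P})

  -- Membership is Bool-valued so that World lives in Set ℓ even for ℓ = 0ℓ.
  record World : Set ℓ where
    field
      mem        : Formula → Bool
      closed     : ∀ {φ} → (T ∘ mem) ⊩ φ → T (mem φ)
      prime      : ∀ {φ ψ} → T (mem (φ ∨' ψ)) → T (mem φ) ⊎ T (mem ψ)
      consistent : ¬ T (mem bot)

  infix 3.5 _∋_
  _∋_ : World → Formula → Set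
  w ∋ φ = T (World.mem w φ)

  module Lindenbaum {B : Pred Formula 0ℓ} {ψ : Formula} (B⊬ψ : ¬ B ⊩ ψ) where

    extend : Pred Formula 0ℓ → Formula → Pred Formula 0ℓ
    extend D χ with decide (D ∪ ｛ χ ｝ ⊩ ψ)
    ... | yes _ = D
    ... | no _  = D ∪ ｛ χ ｝

    ⊆-extend : ∀ D χ → D ⊆ extend D χ
    ⊆-extend D χ χ∈D with decide (D ∪ ｛ χ ｝ ⊩ ψ)
    ... | yes _ = χ∈D
    ... | no _  = inj₁ χ∈D

    extend-consistent : ∀ D χ → ¬ D ⊩ ψ → ¬ extend D χ ⊩ ψ
    extend-consistent D χ D⊬ψ with decide (D ∪ ｛ χ ｝ ⊩ ψ)
    ... | yes _     = D⊬ψ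
    ... | no D,χ⊬ψ = D,χ⊬ψ

    extend-decides : ∀ D χ → extend D χ χ ⊎ (extend D χ ∪ ｛ χ ｝ ⊩ ψ)
    extend-decides D χ with decide (D ∪ ｛ χ ｝ ⊩ ψ)
    ... | yes D,χ⊩ψ = inj₂ D,χ⊩ψ
    ... | no _      = inj₁ (inj₂ refl)

    ⊆-foldl-extend : ∀ D χs → D ⊆ foldl extend D χs
    ⊆-foldl-extend D []       χ∈D = χ∈D
    ⊆-foldl-extend D (χ ∷ χs) χ∈D = ⊆-foldl-extend (extend D χ) χs (⊆-extend D χ χ∈D)

    foldl-extend-consistent : ∀ D χs → ¬ D ⊩ ψ → ¬ foldl extend D χs ⊩ ψ
    foldl-extend-consistent D []       = id
    foldl-extend-consistent D (χ ∷ χs) = foldl-extend-consistent (extend D χ) χs ∘ extend-consistent D χ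

    foldl-extend-decides : ∀ D {χ} χs → χ ∈ χs →
                        foldl extend D χs χ ⊎ (foldl extend D χs ∪ ｛ χ ｝ ⊩ ψ)
    foldl-extend-decides D (χ ∷ χs) (here refl) =
      Sum.map (⊆-foldl-extend _ χs) (⊩-mono (Sum.map₁ (⊆-foldl-extend _ χs))) (extend-decides D χ)
    foldl-extend-decides D (χ ∷ χs) (there χ∈χs) = foldl-extend-decides (extend D χ) χs χ∈χs

    stage : ℕ → Pred Formula 0ℓ
    stage zero    = B
    stage (suc n) = foldl extend (stage n) (formulas n)

    stage-mono : ∀ {m n} → m ≤′ n → stage m ⊆ stage n
    stage-mono ≤′-refl                    χ∈ = χ∈
    stage-mono {n = suc n} (≤′-step m≤′n) χ∈ = ⊆-foldl-extend (stage n) (formulas n) (stage-mono m≤′n χ∈)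

    stage-consistent : ∀ n → ¬ stage n ⊩ ψ
    stage-consistent zero    = B⊬ψ
    stage-consistent (suc n) = foldl-extend-consistent (stage n) (formulas n) (stage-consistent n)

    Th : Pred Formula 0ℓ
    Th χ = ∃ λ n → stage n χ

    ⊩-compact : ∀ {φ} → Th ⊩ φ → ∃ λ n → stage n ⊩ φ
    ⊩-compact (by-thm t)       = 0 , by-thm t
    ⊩-compact (by-hyp (n , h)) = n , by-hyp h
    ⊩-compact (by-mp d e) with ⊩-compact d | ⊩-compact e
    ... | m , d′ | n , e′ = m ⊔ n , by-mp (⊩-mono (stage-mono (≤⇒≤′ (m≤m⊔n m n))) d′)
                                          (⊩-mono (stage-mono (≤⇒≤′ (m≤n⊔m m n))) e′)

    Th-consistent : ¬ Th ⊩ ψ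
    Th-consistent Th⊩ψ = let n , d = ⊩-compact Th⊩ψ in stage-consistent n d

    Th-maximal : ∀ {χ} → ¬ Th χ → Th ∪ ｛ χ ｝ ⊩ ψ
    Th-maximal {χ} χ∉Th with formulas-complete χ
    ... | n , χ∈ with foldl-extend-decides (stage n) (formulas n) χ∈
    ...   | inj₁ χ∈stage = ⊥-elim (χ∉Th (suc n , χ∈stage))
    ...   | inj₂ d       = ⊩-mono (Sum.map₁ (suc n ,_)) d

    Th-closed : ∀ {χ} → Th ⊩ χ → Th χ
    Th-closed {χ} Th⊩χ with decide (Th χ)
    ... | yes χ∈Th = χ∈Th
    ... | no χ∉Th  = ⊥-elim (Th-consistent (by-mp (⊩-deduction (Th-maximal χ∉Th)) Th⊩χ))

    Th-prime : ∀ {α β} → Th (α ∨' β) → Th α ⊎ Th β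
    Th-prime {α} {β} α∨β∈Th with decide (Th α) | decide (Th β)
    ... | yes α∈Th | _        = inj₁ α∈Th
    ... | no _     | yes β∈Th = inj₂ β∈Th
    ... | no α∉Th  | no β∉Th  = ⊥-elim (Th-consistent
          (by-mp (by-mp (by-mp (by-ax (∨E α β ψ)) (⊩-deduction (Th-maximal α∉Th)))
                        (⊩-deduction (Th-maximal β∉Th)))
                 (by-hyp α∨β∈Th)))

    mem : Formula → Bool
    mem χ = isYes (decide (Th χ))

    mem⇒Th : ∀ {χ} → T (mem χ) → Th χ
    mem⇒Th = toWitness

    Th⇒mem : ∀ {χ} → Th χ → T (mem χ)
    Th⇒mem = fromWitness

    world : World
    world = record
      { mem        = mem
      ; closed     = Th⇒mem ∘ Th-closed ∘ ⊩-mono mem⇒Th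
      ; prime      = Sum.map Th⇒mem Th⇒mem ∘ Th-prime ∘ mem⇒Th
      ; consistent = Th-consistent ∘ by-mp (by-ax (efq ψ)) ∘ by-hyp ∘ mem⇒Th
      }

  lindenbaum : ∀ {B ψ} → ¬ B ⊩ ψ → ∃ λ w → B ⊆ (w ∋_) × ¬ w ∋ ψ
  lindenbaum B⊬ψ = world , Th⇒mem ∘ (0 ,_) , Th-consistent ∘ by-hyp ∘ mem⇒Th
    where open Lindenbaum B⊬ψ

  module _ (w : World) where

    ∋-thm : ∀ {φ} → ICK Γ φ → w ∋ φ
    ∋-thm = World.closed w ∘ by-thm

    ∋-mp : ∀ {φ ψ} → w ∋ φ ⇒' ψ → w ∋ φ → w ∋ ψ
    ∋-mp h k = World.closed w (by-mp (by-hyp h) (by-hyp k))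

    ∋-⇒ : ∀ {φ ψ} → ICK Γ (φ ⇒' ψ) → w ∋ φ → w ∋ ψ
    ∋-⇒ = ∋-mp ∘ ∋-thm

    ∋-∧ : ∀ {φ ψ} → w ∋ φ → w ∋ ψ → w ∋ φ ∧' ψ
    ∋-∧ = ∋-mp ∘ ∋-⇒ (ipc (∧I _ _))

    ∋-▷-∧ : ∀ {φ α β} → w ∋ φ ▷ α → w ∋ φ ▷ β → w ∋ φ ▷ (α ∧' β)
    ∋-▷-∧ h k = ∋-⇒ (⇔-from (CM-instance _ _ _)) (∋-∧ h k)

    ∋-▷-mono : ∀ {φ α β} → ICK Γ (α ⇒' β) → w ∋ φ ▷ α → w ∋ φ ▷ β
    ∋-▷-mono {φ} {α} {β} α⇒β =
      ∋-⇒ (ipc (∧E₂ _ _)) ∘ ∋-⇒ (⇔-to (CM-instance φ α β)) ∘ ∋-⇒ (⇔-to (congR φ α⇔α∧β))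
      where
        α⇔α∧β : ICK Γ (α ⇔' α ∧' β)
        α⇔α∧β = ⇔-intro (∅⊩⇒ICK (⊩-deduction
                  (by-mp (by-mp (by-ax (∧I _ _)) (by-hyp (inj₂ refl)))
                         (by-mp (by-thm α⇒β) (by-hyp (inj₂ refl))))))
                (ipc (∧E₁ _ _))

    ∋-▷-thm : ∀ {φ ψ} → ICK Γ ψ → w ∋ φ ▷ ψ
    ∋-▷-thm {φ} {ψ} ⊢ψ = ∋-⇒ (⇔-to (congR φ top⇔ψ)) (∋-thm (mp (⇔-from (CN-instance φ)) (⇒-refl bot)))
      where
        top⇔ψ : ICK Γ (top ⇔' ψ)
        top⇔ψ = ⇔-intro (mp (ipc (K ψ top)) ⊢ψ) (mp (ipc (K top ψ)) (⇒-refl bot))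

    ∋-▷-closed : ∀ {φ ψ} → (λ χ → w ∋ φ ▷ χ) ⊩ ψ → w ∋ φ ▷ ψ
    ∋-▷-closed (by-thm t)  = ∋-▷-thm t
    ∋-▷-closed (by-hyp h)  = h
    ∋-▷-closed (by-mp d e) = ∋-▷-mono modus-ponens (∋-▷-∧ (∋-▷-closed d) (∋-▷-closed e))
      where
        modus-ponens : ∀ {α β} → ICK Γ ((α ⇒' β) ∧' α ⇒' β)
        modus-ponens = ∅⊩⇒ICK (⊩-deduction (by-mp (by-mp (by-ax (∧E₁ _ _)) (by-hyp (inj₂ refl)))
                                                  (by-mp (by-ax (∧E₂ _ _)) (by-hyp (inj₂ refl)))))

  ∋-entailment : ∀ {φ ψ} → (∀ w → w ∋ φ → w ∋ ψ) → ICK Γ (φ ⇒' ψ)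
  ∋-entailment {φ} {ψ} φ⊆ψ with decide (∅ ∪ ｛ φ ｝ ⊩ ψ)
  ... | yes φ⊩ψ = ∅⊩⇒ICK (⊩-deduction φ⊩ψ)
  ... | no φ⊬ψ  = let w , φ∈w , ψ∉w = lindenbaum φ⊬ψ in ⊥-elim (ψ∉w (φ⊆ψ w (φ∈w (inj₂ refl))))

  _⊑_ : World → World → Set
  v ⊑ w = ∀ {φ} → v ∋ φ → w ∋ φ

  -- Without function extensionality ⊑ is antisymmetric only up to extensional equality of
  -- membership, so the order refuses to compare distinct worlds that contain the same formulas.
  _≤_ : World → World → Set ℓ
  v ≤ w = v ≡ w ⊎ (v ⊑ w × ¬ w ⊑ v)

  ≤⇒⊑ : ∀ {v w} → v ≤ w → v ⊑ w
  ≤⇒⊑ (inj₁ refl)      = id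
  ≤⇒⊑ (inj₂ (v⊑w , _)) = v⊑w

  ≤-trans : ∀ {u v w} → u ≤ v → v ≤ w → u ≤ w
  ≤-trans (inj₁ refl)       v≤w                = v≤w
  ≤-trans (inj₂ u<v)        (inj₁ refl)        = inj₂ u<v
  ≤-trans (inj₂ (u⊑v , _)) (inj₂ (v⊑w , w⋢v)) = inj₂ (v⊑w ∘ u⊑v , λ w⊑u → w⋢v (u⊑v ∘ w⊑u))

  ≤-antisym : ∀ {v w} → v ≤ w → w ≤ v → v ≡ w
  ≤-antisym (inj₁ v≡w)        _                  = v≡w
  ≤-antisym (inj₂ _)          (inj₁ w≡v)         = sym w≡v
  ≤-antisym (inj₂ (_ , w⋢v)) (inj₂ (w⊑v , _)) = ⊥-elim (w⋢v w⊑v)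

  ≤-isPartialOrder : IsPartialOrder _≡_ _≤_
  ≤-isPartialOrder = record
    { isPreorder = record { isEquivalence = isEquivalence ; reflexive = inj₁ ; trans = ≤-trans }
    ; antisym    = ≤-antisym
    }

  ⟪_⟫ : Formula → Pred World ℓ
  ⟪ φ ⟫ w = Lift ℓ (w ∋ φ)

  ⟪⟫-injective : ∀ {φ ψ} → ⟪ φ ⟫ ≐ ⟪ ψ ⟫ → ICK Γ (φ ⇔' ψ)
  ⟪⟫-injective φ≐ψ = ⇔-intro (∋-entailment λ w → lower ∘ proj₁ (φ≐ψ w) ∘ lift)
                             (∋-entailment λ w → lower ∘ proj₂ (φ≐ψ w) ∘ lift)

  Rᶜ : Pred World ℓ → World → World → Set ℓ
  Rᶜ a v w = ∀ φ ψ → a ≐ ⟪ φ ⟫ → v ∋ φ ▷ ψ → w ∋ ψ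

  Rᶜ-resp-≐ : ∀ {a b} → a ≐ b → ∀ v w → Rᶜ a v w → Rᶜ b v w
  Rᶜ-resp-≐ a≐b _ _ r φ ψ b≐φ = r φ ψ (≐-trans a≐b b≐φ)

  □Rᶜ-resp-≐ : ∀ {a a′ b b′} → a ≐ a′ → b ≐ b′ → □[ Rᶜ a ] b ≐ □[ Rᶜ a′ ] b′
  □Rᶜ-resp-≐ a≐a′ = □-resp-≐ (Rᶜ-resp-≐ a≐a′) (Rᶜ-resp-≐ (≐-sym a≐a′))

  ⟪bot⟫ : (λ _ → Lift ℓ ⊥) ≐ ⟪ bot ⟫
  ⟪bot⟫ w = (λ ()) , ⊥-elim ∘ World.consistent w ∘ lower

  ⟪top⟫ : (λ _ → Lift ℓ ⊤) ≐ ⟪ top ⟫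
  ⟪top⟫ w = (λ _ → lift (∋-thm w (⇒-refl bot))) , _

  ⟪∧⟫ : ∀ φ ψ → (⟪ φ ⟫ ∩ ⟪ ψ ⟫) ≐ ⟪ φ ∧' ψ ⟫
  ⟪∧⟫ φ ψ w = (λ (lift h , lift k) → lift (∋-∧ w h k))
            , (λ (lift h) → lift (∋-⇒ w (ipc (∧E₁ _ _)) h) , lift (∋-⇒ w (ipc (∧E₂ _ _)) h))

  ⟪∨⟫ : ∀ φ ψ → (⟪ φ ⟫ ∪ ⟪ ψ ⟫) ≐ ⟪ φ ∨' ψ ⟫
  ⟪∨⟫ φ ψ w = Sum.[ (λ (lift h) → lift (∋-⇒ w (ipc (∨I₁ _ _)) h))
                  , (λ (lift k) → lift (∋-⇒ w (ipc (∨I₂ _ _)) k)) ]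
            , Sum.map lift lift ∘ World.prime w ∘ lower

  -- A counter-world v ⊇ w refuting φ ⇒' ψ need not satisfy w ≤ v; if it does not, w itself refutes it.
  ⟪⇒⟫ : ∀ φ ψ → □[ _≤_ ] (⟪ φ ⟫ ⇒ ⟪ ψ ⟫) ≐ ⟪ φ ⇒' ψ ⟫
  ⟪⇒⟫ φ ψ w = to , λ (lift h) v w≤v (lift k) → lift (∋-mp v (≤⇒⊑ w≤v h) k)
    where
      to : □[ _≤_ ] (⟪ φ ⟫ ⇒ ⟪ ψ ⟫) w → ⟪ φ ⇒' ψ ⟫ w
      to H with decide ((w ∋_) ∪ ｛ φ ｝ ⊩ ψ)
      ... | yes w,φ⊩ψ = lift (World.closed w (⊩-deduction w,φ⊩ψ))
      ... | no w,φ⊬ψ with lindenbaum w,φ⊬ψ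
      ...   | v , w,φ⊆v , ψ∉v = ⊥-elim (ψ∉v v∋ψ)
        where
          v∋φ : v ∋ φ
          v∋φ = w,φ⊆v (inj₂ refl)

          v∋ψ : v ∋ ψ
          v∋ψ with decide (v ⊑ w)
          ... | yes v⊑w = w,φ⊆v (inj₁ (lower (H w (inj₁ refl) (lift (v⊑w v∋φ)))))
          ... | no v⋢w  = lower (H v (inj₂ (w,φ⊆v ∘ inj₁ , v⋢w)) (lift v∋φ))

  ⟪▷⟫ : ∀ φ ψ → □[ Rᶜ ⟪ φ ⟫ ] ⟪ ψ ⟫ ≐ ⟪ φ ▷ ψ ⟫
  ⟪▷⟫ φ ψ w = to , λ (lift h) v r → lift (r φ ψ ≐-refl h)
    where
      to : □[ Rᶜ ⟪ φ ⟫ ] ⟪ ψ ⟫ w → ⟪ φ ▷ ψ ⟫ w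
      to H with decide ((λ χ → w ∋ φ ▷ χ) ⊩ ψ)
      ... | yes φ▷⊩ψ = lift (∋-▷-closed w φ▷⊩ψ)
      ... | no φ▷⊬ψ with lindenbaum φ▷⊬ψ
      ...   | v , φ▷⊆v , ψ∉v = ⊥-elim (ψ∉v (lower (H v w-Rᶜ-v)))
        where
          w-Rᶜ-v : Rᶜ ⟪ φ ⟫ w v
          w-Rᶜ-v φ′ χ φ≐φ′ h = φ▷⊆v (∋-⇒ w (⇔-to (congL χ (⟪⟫-injective (≐-sym φ≐φ′)))) h)

  Definable : Pred World ℓ → Set ℓ
  Definable a = ∃ λ φ → a ≐ ⟪ φ ⟫

  canonicalFrame : GFrame ℓ
  canonicalFrame = record
    { X      = World
    ; _≤_    = _≤_
    ; isPO   = ≤-isPartialOrder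
    ; A      = Definable
    ; R      = Rᶜ
    ; A-ext  = λ { a≐b (φ , a≐φ) → φ , ≐-trans (≐-sym a≐b) a≐φ }
    ; R-ext  = λ _ _ a≐b {v} {w} → Rᶜ-resp-≐ a≐b v w
    ; A-up   = λ { (φ , a≐φ) {v} {w} v≤w → proj₂ (a≐φ w) ∘ lift ∘ ≤⇒⊑ v≤w ∘ lower ∘ proj₁ (a≐φ v) }
    ; A-X    = top , ⟪top⟫
    ; A-∅    = bot , ⟪bot⟫
    ; A-∩    = λ { (φ , a≐φ) (ψ , b≐ψ) → φ ∧' ψ , ≐-trans (∩-resp-≐ a≐φ b≐ψ) (⟪∧⟫ φ ψ) }
    ; A-∪    = λ { (φ , a≐φ) (ψ , b≐ψ) → φ ∨' ψ , ≐-trans (∪-resp-≐ a≐φ b≐ψ) (⟪∨⟫ φ ψ) }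
    ; A-→    = λ { (φ , a≐φ) (ψ , b≐ψ) →
                 (φ ⇒' ψ) , ≐-trans (□⇒-resp-≐ a≐φ b≐ψ) (⟪⇒⟫ φ ψ) }
    ; A-⇒    = λ { (φ , a≐φ) (ψ , b≐ψ) →
                 (φ ▷ ψ) , ≐-trans (□Rᶜ-resp-≐ a≐φ b≐ψ) (⟪▷⟫ φ ψ) }
    ; R-cond = λ { _ {z = w} v≤v′ r → w , (λ φ ψ a≐φ → r φ ψ a≐φ ∘ ≤⇒⊑ v≤v′) , inj₁ refl }
    }

  open Soundness canonicalFrame using (⟦_⟧_; ⟦⟧-subst)

  ⟪var⟫ : ℕ → Pred World ℓ
  ⟪var⟫ n = ⟪ var n ⟫

  ⟪var⟫-admissible : ∀ n → Definable (⟪var⟫ n)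
  ⟪var⟫-admissible n = var n , ≐-refl

  truth-lemma : ∀ φ → ⟦ φ ⟧ ⟪var⟫ ≐ ⟪ φ ⟫
  truth-lemma (var n)  = ≐-refl
  truth-lemma bot      = ⟪bot⟫
  truth-lemma (φ ∧' ψ) = ≐-trans (∩-resp-≐ (truth-lemma φ) (truth-lemma ψ)) (⟪∧⟫ φ ψ)
  truth-lemma (φ ∨' ψ) = ≐-trans (∪-resp-≐ (truth-lemma φ) (truth-lemma ψ)) (⟪∨⟫ φ ψ)
  truth-lemma (φ ⇒' ψ) =
    ≐-trans (□⇒-resp-≐ (truth-lemma φ) (truth-lemma ψ)) (⟪⇒⟫ φ ψ)
  truth-lemma (φ ▷ ψ)  =
    ≐-trans (□Rᶜ-resp-≐ (truth-lemma φ) (truth-lemma ψ)) (⟪▷⟫ φ ψ)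

  canonicalFrame-⊨Γ : ValidAll canonicalFrame Γ
  canonicalFrame-⊨Γ {γ} γ∈Γ V AV w =
    proj₂ (⟦⟧-subst ⟪var⟫-admissible AV σ V≐σ γ w)
          (proj₂ (truth-lemma (subst σ γ) w) (lift (∋-thm w (usub σ (hyp γ∈Γ)))))
    where
      σ : ℕ → Formula
      σ = proj₁ ∘ AV

      V≐σ : ∀ n → V n ≐ ⟦ σ n ⟧ ⟪var⟫
      V≐σ n = ≐-trans (proj₂ (AV n)) (≐-sym (truth-lemma (σ n)))

  complete : ∀ {φ} → ((F : GFrame ℓ) → ValidAll F Γ → Valid F φ) → ICK Γ φ
  complete {φ} ⊨φ = mp (∋-entailment λ w _ → w∋φ w) (⇒-refl bot)
    where
      w∋φ : ∀ w → w ∋ φ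
      w∋φ w = lower (proj₁ (truth-lemma φ w)
                           (⊨φ canonicalFrame canonicalFrame-⊨Γ ⟪var⟫ ⟪var⟫-admissible w))

theorem4p25 : ∀ {ℓ : Level} (Γ : Formula → Set) (φ : Formula) →
    (ICK Γ φ → (F : GFrame ℓ) → ValidAll F Γ → Valid F φ)
    × (ExcludedMiddle ℓ → ((F : GFrame ℓ) → ValidAll F Γ → Valid F φ) → ICK Γ φ)
theorem4p25 Γ φ = (λ ⊢φ F ⊨Γ → Soundness.sound F ⊨Γ ⊢φ) , (λ em → Canonical.complete Γ em)
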